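{- Let $\mathrm{inc}^{\mathrm{val}}(n,k)$ be the number of increasing permutations of length $n$ with exactly $k$ valleys. Then $\mathrm{inc}^{\mathrm{val}}(0,0)=1$, $\mathrm{inc}^{\mathrm{val}}(n,0)=2^{n-1}$ for $n\ge1$, and for all $n,k\ge 1$, $$\mathrm{inc}^{\mathrm{val}}(n+1,k)=2\,\mathrm{inc}^{\mathrm{val}}(n,k)+\sum_{i=1}^{n-1}\binom{n}{i}2^{i-1}\,\mathrm{inc}^{\mathrm{val}}(n-i,k-1).$$
   Context: A permutation of $[n]$ is written $\pi=\pi_1\cdots\pi_n$; the empty permutation is included for $n=0$. A valley of $\pi$ is an index $\ell$ with $2\le\ell\le n-1$ and $\pi_{\ell-1}>\pi_\ell<\pi_{\ell+1}$; its height is $\pi_\ell$. A permutation is increasing if the heights of its valleys, read from left to right, form an increasing sequence. -}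

module Defs where

open import Data.Nat using (ℕ; zero; suc; _+_; _*_; _∸_; _^_; _<_; _<ᵇ_; _≡ᵇ_)
open import Data.Nat.Combinatorics using (_C_)
open import Data.Bool using (Bool; true; false; _∧_; if_then_else_)
open import Data.List using (List; []; _∷_; map; concatMap; length; filterᵇ; upTo; applyUpTo)
open import Data.Nat.ListAction using (sum)

-- A permutation of [n] = {1,…,n} is represented as the list π₁ ⋯ πₙ of its values.

insertions : ℕ → List ℕ → List (List ℕ)
insertions x [] = (x ∷ []) ∷ []
insertions x (y ∷ ys) = (x ∷ y ∷ ys) ∷ map (y ∷_) (insertions x ys)

perms : ℕ → List (List ℕ)
perms zero = [] ∷ []
perms (suc n) = concatMap (insertions (suc n)) (perms n)

valleyHeights : List ℕ → List ℕ
valleyHeights (a ∷ rest@(b ∷ c ∷ xs)) =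
  if (b <ᵇ a) ∧ (b <ᵇ c) then b ∷ valleyHeights rest else valleyHeights rest
valleyHeights _ = []

increasingᵇ : List ℕ → Bool
increasingᵇ (a ∷ b ∷ xs) = (a <ᵇ b) ∧ increasingᵇ (b ∷ xs)
increasingᵇ _ = true

isIncreasingPerm : List ℕ → Bool
isIncreasingPerm π = increasingᵇ (valleyHeights π)

numValleys : List ℕ → ℕ
numValleys π = length (valleyHeights π)

incVal : ℕ → ℕ → ℕ
incVal n k = length (filterᵇ (λ π → isIncreasingPerm π ∧ (numValleys π ≡ᵇ k)) (perms n))

-- Σ_{i=lo}^{hi} f i  (empty if hi < lo)
sumFromTo : ℕ → ℕ → (ℕ → ℕ) → ℕ
sumFromTo lo hi f = sum (applyUpTo (λ j → f (lo + j)) (suc hi ∸ lo))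

-- Cut a permutation of 0, …, n at its smallest entry: π = α 0 β. If α or β is empty, the
-- valleys of π are those of the other block. Otherwise 0 is a valley, and as the lowest
-- valley it must be the first one: α has no valleys and β is increasing with k − 1 valleys.
-- Being increasing with a given number of valleys depends only on the relative order of the
-- entries, so by a shuffle identity the sum over all α 0 β factors through the choice of the
-- entries of α, which produces the binomial coefficients. At k = 0 the third case is absent,
-- leaving 2 ^ (i − 1) permutations without valleys of each length i ≥ 1.

module Submission where

open import Defs
open import Data.Bool using (Bool; true; false; _∧_; if_then_else_)
open import Data.Bool.Properties using (if-float; ∧-zeroʳ)
open import Data.List
  using (List; []; _∷_; _++_; [_]; map; concatMap; filterᵇ; length; applyUpTo; applyDownFrom; downFrom)
open import Data.List.Properties
  using (length-map; length-downFrom; map-++; map-∘; map-cong; map-cong-local; map-downFrom; downFrom-∷ʳ; applyUpTo-∷ʳ)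
open import Data.List.Membership.Propositional.Properties using (∈-downFrom⁺)
open import Data.List.Relation.Binary.Sublist.Propositional using (_⊆_; []; _∷_; _∷ʳ_)
open import Data.List.Relation.Binary.Sublist.Propositional.Properties using (All-resp-⊆)
open import Data.List.Relation.Unary.All using (All)
import Data.List.Relation.Unary.All as All
import Data.List.Relation.Unary.All.Properties as All
open import Data.List.Relation.Unary.AllPairs using (AllPairs; []; _∷_)
import Data.List.Relation.Unary.AllPairs.Properties as AllPairs
open import Data.Nat
  using (ℕ; zero; suc; _+_; _*_; _^_; _∸_; _<_; _≤_; _>_; _≥_; _<ᵇ_; _≡ᵇ_; _<?_; z<s; s<s; s≤s)
open import Data.Nat.Properties
  using ( +-assoc; +-comm; +-identityʳ; *-identityˡ; *-identityʳ; *-zeroʳ; *-distribˡ-+; *-distribʳ-+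
        ; +-commutativeSemigroup; ≤-refl; <⇒≤; ≮⇒≥; <-trans; <-≤-trans; <-cmp; m≤m+n; +-monoʳ-<
        ; ∸-monoˡ-<; n∸n≡0; +-∸-assoc; m<n⇒0<n∸m)
open import Algebra.Properties.CommutativeSemigroup +-commutativeSemigroup
  using () renaming (interchange to +-interchange)
open import Data.Nat.Combinatorics using (_C_; k>n⇒nCk≡0; nCk+nC[k+1]≡[n+1]C[k+1])
open import Data.Nat.ListAction using (sum)
open import Data.Nat.ListAction.Properties using (sum-++)
open import Data.Nat.Solver using (module +-*-Solver)
open import Data.Product using (∃; _×_; _,_)
open import Function using (_∘_; id)
open import Relation.Binary using (_Preserves_⟶_; tri<; tri≈; tri>)
open import Relation.Binary.PropositionalEquality
  using (_≡_; refl; sym; trans; cong; cong₂; subst; module ≡-Reasoning)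
open import Relation.Nullary using (yes; no; contradiction)

open +-*-Solver using (solve; _:+_; _:*_; _:=_; con)

Weight : Set
Weight = List ℕ → ℕ

Weight₂ : Set
Weight₂ = List ℕ → List ℕ → ℕ

infix 7 _⊗_

_⊗_ : Weight → Weight → Weight₂
(a ⊗ b) α β = a α * b β

-- splitSum w l sums w α β over all ways of writing l as α ++ β.
splitSum : Weight₂ → Weight
splitSum w [] = w [] []
splitSum w (y ∷ ys) = w [] (y ∷ ys) + splitSum (λ α β → w (y ∷ α) β) ys

splitSum-cong : ∀ {w v : Weight₂} → (∀ α β → w α β ≡ v α β) → ∀ l → splitSum w l ≡ splitSum v l
splitSum-cong eq [] = eq [] []
splitSum-cong eq (y ∷ ys) = cong₂ _+_ (eq _ _) (splitSum-cong (λ α → eq (y ∷ α)) ys)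

splitSum-zero : ∀ l → splitSum (λ _ _ → 0) l ≡ 0
splitSum-zero [] = refl
splitSum-zero (y ∷ ys) = splitSum-zero ys

splitSum-+ : ∀ (w v : Weight₂) l → splitSum (λ α β → w α β + v α β) l ≡ splitSum w l + splitSum v l
splitSum-+ w v [] = refl
splitSum-+ w v (y ∷ ys) = trans
  (cong (w [] (y ∷ ys) + v [] (y ∷ ys) +_) (splitSum-+ (λ α → w (y ∷ α)) (λ α → v (y ∷ α)) ys))
  (+-interchange (w [] (y ∷ ys)) (v [] (y ∷ ys)) _ _)

splitSum-*ˡ : ∀ c (w : Weight₂) l → splitSum (λ α β → c * w α β) l ≡ c * splitSum w l
splitSum-*ˡ c w [] = refl
splitSum-*ˡ c w (y ∷ ys) = trans
  (cong (c * w [] (y ∷ ys) +_) (splitSum-*ˡ c (λ α → w (y ∷ α)) ys))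
  (sym (*-distribˡ-+ c (w [] (y ∷ ys)) _))

splitSum-*ʳ : ∀ c (w : Weight₂) l → splitSum (λ α β → w α β * c) l ≡ splitSum w l * c
splitSum-*ʳ c w [] = refl
splitSum-*ʳ c w (y ∷ ys) = trans
  (cong (w [] (y ∷ ys) * c +_) (splitSum-*ʳ c (λ α → w (y ∷ α)) ys))
  (sym (*-distribʳ-+ c (w [] (y ∷ ys)) _))

splitSum-map : ∀ (h : ℕ → ℕ) (w : Weight₂) l →
  splitSum w (map h l) ≡ splitSum (λ α β → w (map h α) (map h β)) l
splitSum-map h w [] = refl
splitSum-map h w (y ∷ ys) = cong (w [] (h y ∷ map h ys) +_) (splitSum-map h (λ α → w (h y ∷ α)) ys)

-- A cut of γ ++ x ∷ δ falls either inside γ or inside x ∷ δ.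
splitSum-++ : ∀ (w : Weight₂) x γ δ → splitSum w (γ ++ x ∷ δ) ≡
  splitSum (λ γ₁ γ₂ → w γ₁ (γ₂ ++ x ∷ δ)) γ + splitSum (λ δ₁ δ₂ → w (γ ++ x ∷ δ₁) δ₂) δ
splitSum-++ w x [] δ = refl
splitSum-++ w x (g ∷ γ) δ = trans
  (cong (w [] (g ∷ γ ++ x ∷ δ) +_) (splitSum-++ (λ α → w (g ∷ α)) x γ δ))
  (sym (+-assoc (w [] (g ∷ γ ++ x ∷ δ)) _ _))

splitSum-assoc : ∀ (F : List ℕ → List ℕ → List ℕ → ℕ) l →
  splitSum (λ γ δ → splitSum (F γ) δ) l ≡ splitSum (λ α β → splitSum (λ γ δ → F γ δ β) α) l
splitSum-assoc F [] = refl
splitSum-assoc F (y ∷ ys) =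
  begin
    (F [] [] (y ∷ ys) + L) + splitSum (λ γ δ → splitSum (F (y ∷ γ)) δ) ys
  ≡⟨ cong (F [] [] (y ∷ ys) + L +_) (splitSum-assoc (λ γ → F (y ∷ γ)) ys) ⟩
    (F [] [] (y ∷ ys) + L) + R
  ≡⟨ +-assoc (F [] [] (y ∷ ys)) L R ⟩
    F [] [] (y ∷ ys) + (L + R)
  ≡⟨ cong (F [] [] (y ∷ ys) +_)
       (sym (splitSum-+ (λ α → F [] (y ∷ α)) (λ α β → splitSum (λ γ δ → F (y ∷ γ) δ β) α) ys)) ⟩
    F [] [] (y ∷ ys) + splitSum (λ α β → F [] (y ∷ α) β + splitSum (λ γ δ → F (y ∷ γ) δ β) α) ys
  ∎
  where
  open ≡-Reasoning
  L = splitSum (λ α → F [] (y ∷ α)) ys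
  R = splitSum (λ α β → splitSum (λ γ δ → F (y ∷ γ) δ β) α) ys

insertSum : ℕ → Weight → Weight
insertSum x f = splitSum (λ α β → f (α ++ x ∷ β))

insertSum-cong : ∀ x {f g : Weight} → (∀ l → f l ≡ g l) → ∀ l → insertSum x f l ≡ insertSum x g l
insertSum-cong x eq = splitSum-cong (λ α β → eq (α ++ x ∷ β))

insertSum-comm : ∀ x y (f : Weight) l → insertSum x (insertSum y f) l ≡ insertSum y (insertSum x f) l
insertSum-comm x y f [] = +-comm (f (y ∷ x ∷ [])) (f (x ∷ y ∷ []))
insertSum-comm x y f (z ∷ zs) =
  begin
    (f (y ∷ x ∷ z ∷ zs) + (f (x ∷ y ∷ z ∷ zs) + Iy)) + insertSum x (λ w → insertSum y f (z ∷ w)) zs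
  ≡⟨ cong (f (y ∷ x ∷ z ∷ zs) + (f (x ∷ y ∷ z ∷ zs) + Iy) +_)
       (splitSum-+ (λ α β → f (y ∷ z ∷ α ++ x ∷ β)) (λ α β → insertSum y fz (α ++ x ∷ β)) zs) ⟩
    (f (y ∷ x ∷ z ∷ zs) + (f (x ∷ y ∷ z ∷ zs) + Iy)) + (Ix + insertSum x (insertSum y fz) zs)
  ≡⟨ cong (λ t → (f (y ∷ x ∷ z ∷ zs) + (f (x ∷ y ∷ z ∷ zs) + Iy)) + (Ix + t)) (insertSum-comm x y fz zs) ⟩
    (f (y ∷ x ∷ z ∷ zs) + (f (x ∷ y ∷ z ∷ zs) + Iy)) + (Ix + insertSum y (insertSum x fz) zs)
  ≡⟨ solve 5 (λ a b c d e → (a :+ (b :+ c)) :+ (d :+ e) := (b :+ (a :+ d)) :+ (c :+ e)) refl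
       (f (y ∷ x ∷ z ∷ zs)) (f (x ∷ y ∷ z ∷ zs)) Iy Ix (insertSum y (insertSum x fz) zs) ⟩
    (f (x ∷ y ∷ z ∷ zs) + (f (y ∷ x ∷ z ∷ zs) + Ix)) + (Iy + insertSum y (insertSum x fz) zs)
  ≡⟨ cong (f (x ∷ y ∷ z ∷ zs) + (f (y ∷ x ∷ z ∷ zs) + Ix) +_)
       (sym (splitSum-+ (λ α β → f (x ∷ z ∷ α ++ y ∷ β)) (λ α β → insertSum x fz (α ++ y ∷ β)) zs)) ⟩
    (f (x ∷ y ∷ z ∷ zs) + (f (y ∷ x ∷ z ∷ zs) + Ix)) + insertSum y (λ w → insertSum x f (z ∷ w)) zs
  ∎
  where
  open ≡-Reasoning
  fz : Weight
  fz v = f (z ∷ v)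
  Iy = insertSum y (λ w → f (x ∷ z ∷ w)) zs
  Ix = insertSum x (λ w → f (y ∷ z ∷ w)) zs

insertSum-map : ∀ (h : ℕ → ℕ) x (f : Weight) l →
  insertSum (h x) f (map h l) ≡ insertSum x (λ w → f (map h w)) l
insertSum-map h x f l = trans (splitSum-map h (λ α β → f (α ++ h x ∷ β)) l)
  (splitSum-cong (λ α β → cong f (sym (map-++ h α (x ∷ β)))) l)

-- arrangeSum f xs sums f over all (length xs)! arrangements of xs.
arrangeSum : Weight → List ℕ → ℕ
arrangeSum f [] = f []
arrangeSum f (x ∷ xs) = arrangeSum (insertSum x f) xs

arrangeSum-cong : ∀ {f g : Weight} → (∀ l → f l ≡ g l) → ∀ xs → arrangeSum f xs ≡ arrangeSum g xs
arrangeSum-cong eq [] = eq []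
arrangeSum-cong eq (x ∷ xs) = arrangeSum-cong (insertSum-cong x eq) xs

arrangeSum-zero : ∀ xs → arrangeSum (λ _ → 0) xs ≡ 0
arrangeSum-zero [] = refl
arrangeSum-zero (x ∷ xs) = trans (arrangeSum-cong splitSum-zero xs) (arrangeSum-zero xs)

arrangeSum-+ : ∀ (f g : Weight) xs → arrangeSum (λ σ → f σ + g σ) xs ≡ arrangeSum f xs + arrangeSum g xs
arrangeSum-+ f g [] = refl
arrangeSum-+ f g (x ∷ xs) = trans
  (arrangeSum-cong (splitSum-+ (λ α β → f (α ++ x ∷ β)) (λ α β → g (α ++ x ∷ β))) xs)
  (arrangeSum-+ (insertSum x f) (insertSum x g) xs)

arrangeSum-++-[] : ∀ (f : Weight) x l → arrangeSum f (l ++ [ x ]) ≡ arrangeSum f (x ∷ l)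
arrangeSum-++-[] f x [] = refl
arrangeSum-++-[] f x (y ∷ l) = trans (arrangeSum-++-[] (insertSum y f) x l) (arrangeSum-cong (insertSum-comm x y f) l)

arrangeSum-map : ∀ (h : ℕ → ℕ) (f : Weight) xs → arrangeSum f (map h xs) ≡ arrangeSum (λ w → f (map h w)) xs
arrangeSum-map h f [] = refl
arrangeSum-map h f (x ∷ xs) = trans (arrangeSum-map h (insertSum (h x) f) xs) (arrangeSum-cong (insertSum-map h x f) xs)

-- Inserting x into a cut arrangement α ++ β puts x either into α or into β.
insertSum-splitSum : ∀ x (a b : Weight) l →
  insertSum x (splitSum (a ⊗ b)) l ≡ splitSum (insertSum x a ⊗ b) l + splitSum (a ⊗ insertSum x b) l
insertSum-splitSum x a b l =
  begin
    splitSum (λ γ δ → splitSum (a ⊗ b) (γ ++ x ∷ δ)) l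
  ≡⟨ splitSum-cong (λ γ δ → splitSum-++ (a ⊗ b) x γ δ) l ⟩
    splitSum (λ γ δ → splitSum (λ γ₁ γ₂ → a γ₁ * b (γ₂ ++ x ∷ δ)) γ
                    + splitSum (λ δ₁ δ₂ → a (γ ++ x ∷ δ₁) * b δ₂) δ) l
  ≡⟨ splitSum-+ _ _ l ⟩
    splitSum (λ γ δ → splitSum (λ γ₁ γ₂ → a γ₁ * b (γ₂ ++ x ∷ δ)) γ) l
      + splitSum (λ γ δ → splitSum (λ δ₁ δ₂ → a (γ ++ x ∷ δ₁) * b δ₂) δ) l
  ≡⟨ cong₂ _+_ (sym (splitSum-assoc (λ γ₁ γ₂ δ → a γ₁ * b (γ₂ ++ x ∷ δ)) l))
               (splitSum-assoc (λ γ δ₁ δ₂ → a (γ ++ x ∷ δ₁) * b δ₂) l) ⟩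
    splitSum (λ α β → splitSum (λ γ δ → a α * b (γ ++ x ∷ δ)) β) l
      + splitSum (λ α β → splitSum (λ γ δ → a (γ ++ x ∷ δ) * b β) α) l
  ≡⟨ cong₂ _+_ (splitSum-cong (λ α β → splitSum-*ˡ (a α) (λ γ δ → b (γ ++ x ∷ δ)) β) l)
               (splitSum-cong (λ α β → splitSum-*ʳ (b β) (λ γ δ → a (γ ++ x ∷ δ)) α) l) ⟩
    splitSum (a ⊗ insertSum x b) l + splitSum (insertSum x a ⊗ b) l
  ≡⟨ +-comm (splitSum (a ⊗ insertSum x b) l) _ ⟩
    splitSum (insertSum x a ⊗ b) l + splitSum (a ⊗ insertSum x b) l
  ∎
  where open ≡-Reasoning

-- distributeSum w xs sums w S T over the 2 ^ length xs splittings of xs into complementary subsequences S, T.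
distributeSum : Weight₂ → List ℕ → ℕ
distributeSum w [] = w [] []
distributeSum w (x ∷ xs) = distributeSum (λ S T → w (x ∷ S) T) xs + distributeSum (λ S T → w S (x ∷ T)) xs

distributeSum-cong : ∀ {w v : Weight₂} → (∀ S T → w S T ≡ v S T) →
  ∀ xs → distributeSum w xs ≡ distributeSum v xs
distributeSum-cong eq [] = eq [] []
distributeSum-cong eq (x ∷ xs) =
  cong₂ _+_ (distributeSum-cong (λ S → eq (x ∷ S)) xs) (distributeSum-cong (λ S T → eq S (x ∷ T)) xs)

distributeSum-zero : ∀ xs → distributeSum (λ _ _ → 0) xs ≡ 0
distributeSum-zero [] = refl
distributeSum-zero (x ∷ xs) = cong₂ _+_ (distributeSum-zero xs) (distributeSum-zero xs)

arrangeSum-splitSum : ∀ (a b : Weight) xs →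
  arrangeSum (splitSum (a ⊗ b)) xs ≡ distributeSum (λ S T → arrangeSum a S * arrangeSum b T) xs
arrangeSum-splitSum a b [] = refl
arrangeSum-splitSum a b (x ∷ xs) =
  begin
    arrangeSum (insertSum x (splitSum (a ⊗ b))) xs
  ≡⟨ arrangeSum-cong (insertSum-splitSum x a b) xs ⟩
    arrangeSum (λ σ → splitSum (insertSum x a ⊗ b) σ + splitSum (a ⊗ insertSum x b) σ) xs
  ≡⟨ arrangeSum-+ (splitSum (insertSum x a ⊗ b)) (splitSum (a ⊗ insertSum x b)) xs ⟩
    arrangeSum (splitSum (insertSum x a ⊗ b)) xs + arrangeSum (splitSum (a ⊗ insertSum x b)) xs
  ≡⟨ cong₂ _+_ (arrangeSum-splitSum (insertSum x a) b xs) (arrangeSum-splitSum a (insertSum x b) xs) ⟩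
    distributeSum (λ S T → arrangeSum a (x ∷ S) * arrangeSum b T) xs
      + distributeSum (λ S T → arrangeSum a S * arrangeSum b (x ∷ T)) xs
  ∎
  where open ≡-Reasoning

arrangeSum-splitSum-+ : ∀ (w v : Weight₂) xs →
  arrangeSum (splitSum (λ α β → w α β + v α β)) xs ≡ arrangeSum (splitSum w) xs + arrangeSum (splitSum v) xs
arrangeSum-splitSum-+ w v xs = trans (arrangeSum-cong (splitSum-+ w v) xs) (arrangeSum-+ (splitSum w) (splitSum v) xs)

isEmpty : Weight
isEmpty [] = 1
isEmpty (_ ∷ _) = 0

_⁺ : Weight → Weight
(a ⁺) [] = 0
(a ⁺) (x ∷ xs) = a (x ∷ xs)

isEmpty-++-∷ : ∀ α x β → isEmpty (α ++ x ∷ β) ≡ 0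
isEmpty-++-∷ [] x β = refl
isEmpty-++-∷ (_ ∷ _) x β = refl

⁺-++-∷ : ∀ (a : Weight) α x β → (a ⁺) (α ++ x ∷ β) ≡ a (α ++ x ∷ β)
⁺-++-∷ a [] x β = refl
⁺-++-∷ a (_ ∷ _) x β = refl

arrangeSum-isEmpty : ∀ S → arrangeSum isEmpty S ≡ isEmpty S
arrangeSum-isEmpty [] = refl
arrangeSum-isEmpty (x ∷ S) = trans
  (arrangeSum-cong (λ l → trans (splitSum-cong (λ α β → isEmpty-++-∷ α x β) l) (splitSum-zero l)) S)
  (arrangeSum-zero S)

arrangeSum-⁺ : ∀ (a : Weight) x S → arrangeSum (a ⁺) (x ∷ S) ≡ arrangeSum a (x ∷ S)
arrangeSum-⁺ a x = arrangeSum-cong (splitSum-cong (λ α β → ⁺-++-∷ a α x β))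

distributeSum-isEmptyˡ : ∀ (g : Weight) xs → distributeSum (λ S T → isEmpty S * g T) xs ≡ g xs
distributeSum-isEmptyˡ g [] = +-identityʳ (g [])
distributeSum-isEmptyˡ g (x ∷ xs) =
  cong₂ _+_ (distributeSum-zero xs) (distributeSum-isEmptyˡ (λ T → g (x ∷ T)) xs)

distributeSum-isEmptyʳ : ∀ (f : Weight) xs → distributeSum (λ S T → f S * isEmpty T) xs ≡ f xs
distributeSum-isEmptyʳ f [] = *-identityʳ (f [])
distributeSum-isEmptyʳ f (x ∷ xs) = trans
  (cong₂ _+_ (distributeSum-isEmptyʳ (λ S → f (x ∷ S)) xs)
             (trans (distributeSum-cong (λ S T → *-zeroʳ (f S)) xs) (distributeSum-zero xs)))
  (+-identityʳ (f (x ∷ xs)))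

arrangeSum-splitSum-isEmptyˡ : ∀ (b : Weight) xs → arrangeSum (splitSum (isEmpty ⊗ b)) xs ≡ arrangeSum b xs
arrangeSum-splitSum-isEmptyˡ b xs = trans (arrangeSum-splitSum isEmpty b xs)
  (trans (distributeSum-cong (λ S T → cong (_* arrangeSum b T) (arrangeSum-isEmpty S)) xs)
         (distributeSum-isEmptyˡ (arrangeSum b) xs))

arrangeSum-splitSum-isEmptyʳ : ∀ (a : Weight) xs → arrangeSum (splitSum (a ⊗ isEmpty)) xs ≡ arrangeSum a xs
arrangeSum-splitSum-isEmptyʳ a xs = trans (arrangeSum-splitSum a isEmpty xs)
  (trans (distributeSum-cong (λ S T → cong (arrangeSum a S *_) (arrangeSum-isEmpty T)) xs)
         (distributeSum-isEmptyʳ (arrangeSum a) xs))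

<⇒<ᵇ≡true : ∀ {m n} → m < n → (m <ᵇ n) ≡ true
<⇒<ᵇ≡true {zero} {suc n} _ = refl
<⇒<ᵇ≡true {suc m} {suc n} (s<s m<n) = <⇒<ᵇ≡true m<n

≥⇒<ᵇ≡false : ∀ {m n} → n ≤ m → (m <ᵇ n) ≡ false
≥⇒<ᵇ≡false {m} {zero} _ = refl
≥⇒<ᵇ≡false {suc m} {suc n} (s≤s n≤m) = ≥⇒<ᵇ≡false n≤m

StrictlyMonotone : (ℕ → ℕ) → Set
StrictlyMonotone h = h Preserves _<_ ⟶ _<_

suc-monotone : StrictlyMonotone suc
suc-monotone = s<s

<ᵇ-preserved : ∀ {h} → StrictlyMonotone h → ∀ a b → (h a <ᵇ h b) ≡ (a <ᵇ b)
<ᵇ-preserved {h} mono a b with <-cmp a b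
... | tri< a<b _ _ = trans (<⇒<ᵇ≡true (mono a<b)) (sym (<⇒<ᵇ≡true a<b))
... | tri≈ _ refl _ = trans (≥⇒<ᵇ≡false (≤-refl {h a})) (sym (≥⇒<ᵇ≡false (≤-refl {a})))
... | tri> _ _ b<a = trans (≥⇒<ᵇ≡false (<⇒≤ (mono b<a))) (sym (≥⇒<ᵇ≡false (<⇒≤ b<a)))

extendFrom : ℕ → ℕ → (ℕ → ℕ) → ℕ → ℕ
extendFrom m s h i = if i <ᵇ m then h i else s + (i ∸ m)

module _ {m s : ℕ} {h : ℕ → ℕ} where

  extendFrom-< : ∀ {i} → i < m → extendFrom m s h i ≡ h i
  extendFrom-< i<m rewrite <⇒<ᵇ≡true i<m = refl

  extendFrom-≥ : ∀ {i} → m ≤ i → extendFrom m s h i ≡ s + (i ∸ m)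
  extendFrom-≥ m≤i rewrite ≥⇒<ᵇ≡false m≤i = refl

  extendFrom-monotone : StrictlyMonotone h → (∀ {i} → i < m → h i < s) → StrictlyMonotone (extendFrom m s h)
  extendFrom-monotone mono h<s {i} {j} i<j with i <? m | j <? m
  ... | yes i<m | yes j<m rewrite extendFrom-< i<m | extendFrom-< j<m = mono i<j
  ... | yes i<m | no j≮m rewrite extendFrom-< i<m | extendFrom-≥ (≮⇒≥ j≮m) =
    <-≤-trans (h<s i<m) (m≤m+n s (j ∸ m))
  ... | no i≮m | yes j<m = contradiction (<-trans i<j j<m) i≮m
  ... | no i≮m | no j≮m rewrite extendFrom-≥ (≮⇒≥ i≮m) | extendFrom-≥ (≮⇒≥ j≮m) =
    +-monoʳ-< s (∸-monoˡ-< i<j (≮⇒≥ i≮m))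

strictlyDecreasing-relabelling : ∀ {S} → AllPairs _>_ S →
  ∃ λ h → StrictlyMonotone h × S ≡ map h (downFrom (length S))
strictlyDecreasing-relabelling [] = id , id , refl
strictlyDecreasing-relabelling {s ∷ S} (s>S ∷ S↓) with strictlyDecreasing-relabelling S↓
... | h , mono , S≡ =
  extendFrom m s h , extendFrom-monotone mono h<s ,
  cong₂ _∷_ (sym (trans (extendFrom-≥ {m} {s} {h} ≤-refl) (trans (cong (s +_) (n∸n≡0 m)) (+-identityʳ s))))
            (trans S≡ (map-cong-local (All.applyDownFrom⁺₁ id m (λ i<m → sym (extendFrom-< {m} {s} {h} i<m)))))
  where
  m = length S
  h<s : ∀ {i} → i < m → h i < s
  h<s i<m = All.lookup (All.map⁻ (subst (All (_< s)) S≡ s>S)) (∈-downFrom⁺ i<m)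

OrderInvariant : Weight → Set
OrderInvariant a = ∀ {h} → StrictlyMonotone h → ∀ σ → a (map h σ) ≡ a σ

⁺-orderInvariant : ∀ {a} → OrderInvariant a → OrderInvariant (a ⁺)
⁺-orderInvariant inv mono [] = refl
⁺-orderInvariant inv mono (x ∷ σ) = inv mono (x ∷ σ)

arrangeSum-orderInvariant : ∀ {a} → OrderInvariant a → ∀ {S} → AllPairs _>_ S →
  arrangeSum a S ≡ arrangeSum a (downFrom (length S))
arrangeSum-orderInvariant {a} inv {S} S↓ with strictlyDecreasing-relabelling S↓
... | h , mono , S≡ = trans (cong (arrangeSum a) S≡)
  (trans (arrangeSum-map h a (downFrom (length S))) (arrangeSum-cong (inv mono) (downFrom (length S))))

AllPairs-resp-⊆ : ∀ {R : ℕ → ℕ → Set} {xs ys} → xs ⊆ ys → AllPairs R ys → AllPairs R xs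
AllPairs-resp-⊆ [] [] = []
AllPairs-resp-⊆ (y ∷ʳ xs⊆ys) (_ ∷ ys) = AllPairs-resp-⊆ xs⊆ys ys
AllPairs-resp-⊆ (refl ∷ xs⊆ys) (x ∷ ys) = All-resp-⊆ xs⊆ys x ∷ AllPairs-resp-⊆ xs⊆ys ys

downFrom-decreasing : ∀ n → AllPairs _>_ (downFrom n)
downFrom-decreasing n = AllPairs.applyDownFrom⁺₁ id n (λ j<i _ → j<i)

permSum : Weight → ℕ → ℕ
permSum a n = arrangeSum a (downFrom n)

permSum-⁺ : ∀ (a : Weight) m → 0 < m → permSum (a ⁺) m ≡ permSum a m
permSum-⁺ a (suc m) _ = arrangeSum-⁺ a m (downFrom m)

binomialConv : (ℕ → ℕ) → (ℕ → ℕ) → ℕ → ℕ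
binomialConv c d zero = c 0 * d 0
binomialConv c d (suc n) = binomialConv (c ∘ suc) d n + binomialConv c (d ∘ suc) n

distributeSum-length : ∀ xs (w : Weight₂) (c d : ℕ → ℕ) →
  (∀ {S T} → S ⊆ xs → T ⊆ xs → w S T ≡ c (length S) * d (length T)) →
  distributeSum w xs ≡ binomialConv c d (length xs)
distributeSum-length [] w c d w≡ = w≡ [] []
distributeSum-length (x ∷ xs) w c d w≡ = cong₂ _+_
  (distributeSum-length xs (λ S T → w (x ∷ S) T) (c ∘ suc) d (λ S⊆ T⊆ → w≡ (refl ∷ S⊆) (x ∷ʳ T⊆)))
  (distributeSum-length xs (λ S T → w S (x ∷ T)) c (d ∘ suc) (λ S⊆ T⊆ → w≡ (x ∷ʳ S⊆) (refl ∷ T⊆)))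

distributeSum-permSum : ∀ {a b} → OrderInvariant a → OrderInvariant b → ∀ n →
  distributeSum (λ S T → arrangeSum a S * arrangeSum b T) (downFrom n) ≡ binomialConv (permSum a) (permSum b) n
distributeSum-permSum {a} {b} inv-a inv-b n = trans
  (distributeSum-length (downFrom n) _ (permSum a) (permSum b) (λ S⊆ T⊆ → cong₂ _*_
    (arrangeSum-orderInvariant inv-a (AllPairs-resp-⊆ S⊆ (downFrom-decreasing n)))
    (arrangeSum-orderInvariant inv-b (AllPairs-resp-⊆ T⊆ (downFrom-decreasing n)))))
  (cong (binomialConv (permSum a) (permSum b)) (length-downFrom n))

sumUpTo : ℕ → (ℕ → ℕ) → ℕ
sumUpTo m f = sum (applyUpTo f m)

sumUpTo-suc : ∀ m f → sumUpTo (suc m) f ≡ sumUpTo m f + f m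
sumUpTo-suc m f = begin
  sum (applyUpTo f (suc m))                 ≡⟨ cong sum (sym (applyUpTo-∷ʳ f m)) ⟩
  sum (applyUpTo f m ++ [ f m ])            ≡⟨ sum-++ (applyUpTo f m) [ f m ] ⟩
  sum (applyUpTo f m) + (f m + 0)           ≡⟨ cong (sum (applyUpTo f m) +_) (+-identityʳ (f m)) ⟩
  sum (applyUpTo f m) + f m                 ∎
  where open ≡-Reasoning

sumUpTo-cong : ∀ m {f g : ℕ → ℕ} → (∀ {j} → j < m → f j ≡ g j) → sumUpTo m f ≡ sumUpTo m g
sumUpTo-cong zero eq = refl
sumUpTo-cong (suc m) eq = cong₂ _+_ (eq z<s) (sumUpTo-cong m (λ j<m → eq (s<s j<m)))

sumUpTo-+ : ∀ m (f g : ℕ → ℕ) → sumUpTo m (λ j → f j + g j) ≡ sumUpTo m f + sumUpTo m g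
sumUpTo-+ zero f g = refl
sumUpTo-+ (suc m) f g = trans
  (cong (f 0 + g 0 +_) (sumUpTo-+ m (f ∘ suc) (g ∘ suc)))
  (+-interchange (f 0) (g 0) _ _)

binomialTerm : (ℕ → ℕ) → (ℕ → ℕ) → ℕ → ℕ → ℕ
binomialTerm c d n j = (n C j) * c j * d (n ∸ j)

pascal-* : ∀ n j y z → (n C j) * y * z + (n C suc j) * y * z ≡ (suc n C suc j) * y * z
pascal-* n j y z = begin
  (n C j) * y * z + (n C suc j) * y * z    ≡⟨ *-distribʳ-+ z ((n C j) * y) _ ⟨
  ((n C j) * y + (n C suc j) * y) * z      ≡⟨ cong (_* z) (*-distribʳ-+ y (n C j) (n C suc j)) ⟨
  ((n C j + n C suc j) * y) * z            ≡⟨ cong (λ t → t * y * z) (nCk+nC[k+1]≡[n+1]C[k+1] n j) ⟩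
  (suc n C suc j) * y * z                  ∎
  where open ≡-Reasoning

binomialConv-closed : ∀ c d n → binomialConv c d n ≡ sumUpTo (suc n) (binomialTerm c d n)
binomialConv-closed c d zero = sym (trans (+-identityʳ (1 * c 0 * d 0)) (cong (_* d 0) (*-identityˡ (c 0))))
binomialConv-closed c d (suc n) =
  begin
    binomialConv (c ∘ suc) d n + binomialConv c (d ∘ suc) n
  ≡⟨ cong₂ _+_ (binomialConv-closed (c ∘ suc) d n) (binomialConv-closed c (d ∘ suc) n) ⟩
    sumUpTo (suc n) left + (first + sumUpTo n (λ j → (n C suc j) * c (suc j) * d (suc (n ∸ suc j))))
  ≡⟨ cong (λ t → sumUpTo (suc n) left + (first + t)) (sumUpTo-cong n (λ {j} j<n →
       cong (λ t → (n C suc j) * c (suc j) * d t) (sym (+-∸-assoc 1 j<n)))) ⟩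
    sumUpTo (suc n) left + (first + sumUpTo n right)
  ≡⟨ cong (λ t → sumUpTo (suc n) left + (first + t)) (sym (trans (sumUpTo-suc n right)
       (trans (cong (λ t → sumUpTo n right + t * c (suc n) * d (n ∸ n)) (k>n⇒nCk≡0 {n} {suc n} ≤-refl))
              (+-identityʳ (sumUpTo n right))))) ⟩
    sumUpTo (suc n) left + (first + sumUpTo (suc n) right)
  ≡⟨ solve 3 (λ x t z → x :+ (t :+ z) := t :+ (x :+ z)) refl (sumUpTo (suc n) left) first _ ⟩
    first + (sumUpTo (suc n) left + sumUpTo (suc n) right)
  ≡⟨ cong (first +_) (sym (sumUpTo-+ (suc n) left right)) ⟩
    first + sumUpTo (suc n) (λ j → left j + right j)
  ≡⟨ cong (first +_) (sumUpTo-cong (suc n) (λ {j} _ → pascal-* n j (c (suc j)) (d (n ∸ j)))) ⟩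
    sumUpTo (suc (suc n)) (binomialTerm c d (suc n))
  ∎
  where
  open ≡-Reasoning
  first = 1 * c 0 * d (suc n)
  left right : ℕ → ℕ
  left j = (n C j) * c (suc j) * d (n ∸ j)
  right j = (n C suc j) * c (suc j) * d (n ∸ j)

binomialConv-vanishʳ : ∀ c {d} → (∀ j → d j ≡ 0) → ∀ n → binomialConv c d n ≡ 0
binomialConv-vanishʳ c d≡0 zero = trans (cong (c 0 *_) (d≡0 0)) (*-zeroʳ (c 0))
binomialConv-vanishʳ c d≡0 (suc n) =
  cong₂ _+_ (binomialConv-vanishʳ (c ∘ suc) d≡0 n) (binomialConv-vanishʳ c (d≡0 ∘ suc) n)

binomialConv-interior : ∀ {c d} → c 0 ≡ 0 → d 0 ≡ 0 → ∀ n →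
  binomialConv c d (suc n) ≡ sumUpTo n (λ i → (suc n C suc i) * c (suc i) * d (n ∸ i))
binomialConv-interior {c} {d} c0≡0 d0≡0 n =
  begin
    binomialConv c d (suc n)
  ≡⟨ binomialConv-closed c d (suc n) ⟩
    binomialTerm c d (suc n) 0 + sumUpTo (suc n) (binomialTerm c d (suc n) ∘ suc)
  ≡⟨ cong₂ _+_ firstTerm≡0 (sumUpTo-suc n (binomialTerm c d (suc n) ∘ suc)) ⟩
    sumUpTo n (binomialTerm c d (suc n) ∘ suc) + binomialTerm c d (suc n) (suc n)
  ≡⟨ cong (sumUpTo n (binomialTerm c d (suc n) ∘ suc) +_) lastTerm≡0 ⟩
    sumUpTo n (binomialTerm c d (suc n) ∘ suc) + 0
  ≡⟨ +-identityʳ _ ⟩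
    sumUpTo n (binomialTerm c d (suc n) ∘ suc)
  ∎
  where
  open ≡-Reasoning
  firstTerm≡0 : binomialTerm c d (suc n) 0 ≡ 0
  firstTerm≡0 = trans (cong (λ t → (suc n C 0) * t * d (suc n)) c0≡0)
                      (cong (_* d (suc n)) (*-zeroʳ (suc n C 0)))
  lastTerm≡0 : binomialTerm c d (suc n) (suc n) ≡ 0
  lastTerm≡0 = trans (cong (λ t → (suc n C suc n) * c (suc n) * d t) (n∸n≡0 n))
                     (trans (cong ((suc n C suc n) * c (suc n) *_) d0≡0) (*-zeroʳ ((suc n C suc n) * c (suc n))))

indicator : Bool → ℕ
indicator true = 1
indicator false = 0

incIndicator : ℕ → List ℕ → ℕ
incIndicator k V = indicator (increasingᵇ V ∧ (length V ≡ᵇ k))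

incWeight : ℕ → Weight
incWeight k σ = incIndicator k (valleyHeights σ)

-- incWeight (k ∸ 1) for k ≥ 1; at k = 0 it must vanish, since a permutation with a valley at 0 has at least one valley.
incWeightPred : ℕ → Weight
incWeightPred zero _ = 0
incWeightPred (suc k) = incWeight k

valleyHeights-map : ∀ {h} → StrictlyMonotone h → ∀ l → valleyHeights (map h l) ≡ map h (valleyHeights l)
valleyHeights-map mono [] = refl
valleyHeights-map mono (a ∷ []) = refl
valleyHeights-map mono (a ∷ b ∷ []) = refl
valleyHeights-map {h} mono (a ∷ l@(b ∷ c ∷ _)) = trans
  (cong₂ (λ isValley V → if isValley then h b ∷ V else V)
         (cong₂ _∧_ (<ᵇ-preserved mono b a) (<ᵇ-preserved mono b c)) (valleyHeights-map mono l))
  (sym (if-float (map h) ((b <ᵇ a) ∧ (b <ᵇ c))))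

increasingᵇ-map : ∀ {h} → StrictlyMonotone h → ∀ l → increasingᵇ (map h l) ≡ increasingᵇ l
increasingᵇ-map mono [] = refl
increasingᵇ-map mono (a ∷ []) = refl
increasingᵇ-map mono (a ∷ l@(b ∷ _)) = cong₂ _∧_ (<ᵇ-preserved mono a b) (increasingᵇ-map mono l)

incWeight-orderInvariant : ∀ k → OrderInvariant (incWeight k)
incWeight-orderInvariant k {h} mono σ
  rewrite valleyHeights-map mono σ | increasingᵇ-map mono (valleyHeights σ) | length-map h (valleyHeights σ) = refl

incWeightPred-orderInvariant : ∀ k → OrderInvariant (incWeightPred k)
incWeightPred-orderInvariant zero mono σ = refl
incWeightPred-orderInvariant (suc k) = incWeight-orderInvariant k

valleyHeights-0∷ : ∀ l → valleyHeights (0 ∷ l) ≡ valleyHeights l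
valleyHeights-0∷ [] = refl
valleyHeights-0∷ (b ∷ []) = refl
valleyHeights-0∷ (b ∷ c ∷ l) = refl

valleyHeights-++-0 : ∀ l → valleyHeights (l ++ [ 0 ]) ≡ valleyHeights l
valleyHeights-++-0 [] = refl
valleyHeights-++-0 (a ∷ []) = refl
valleyHeights-++-0 (a ∷ b ∷ []) rewrite ∧-zeroʳ (b <ᵇ a) = refl
valleyHeights-++-0 (a ∷ l@(b ∷ c ∷ _)) =
  cong (λ V → if (b <ᵇ a) ∧ (b <ᵇ c) then b ∷ V else V) (valleyHeights-++-0 l)

valleyHeights-++-0∷ : ∀ a α b r → valleyHeights (suc a ∷ map suc α ++ 0 ∷ suc b ∷ r)
                               ≡ valleyHeights (suc a ∷ map suc α) ++ 0 ∷ valleyHeights (suc b ∷ r)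
valleyHeights-++-0∷ a [] b r = cong (0 ∷_) (valleyHeights-0∷ (suc b ∷ r))
valleyHeights-++-0∷ a (y ∷ []) b r rewrite ∧-zeroʳ (y <ᵇ a) = valleyHeights-++-0∷ y [] b r
valleyHeights-++-0∷ a (y ∷ α@(z ∷ _)) b r = trans
  (cong (λ V → if (y <ᵇ a) ∧ (y <ᵇ z) then suc y ∷ V else V) (valleyHeights-++-0∷ y α b r))
  (sym (if-float (_++ 0 ∷ valleyHeights (suc b ∷ r)) ((y <ᵇ a) ∧ (y <ᵇ z))))

increasingᵇ-0∷ : ∀ B → increasingᵇ (0 ∷ map suc B) ≡ increasingᵇ B
increasingᵇ-0∷ [] = refl
increasingᵇ-0∷ (b ∷ B) = increasingᵇ-map suc-monotone (b ∷ B)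

increasingᵇ-++-0∷ : ∀ a A R → increasingᵇ (suc a ∷ map suc A ++ 0 ∷ R) ≡ false
increasingᵇ-++-0∷ a [] R = refl
increasingᵇ-++-0∷ a (y ∷ A) R rewrite increasingᵇ-++-0∷ y A R = ∧-zeroʳ (a <ᵇ y)

-- A valley of height 0 must come first, so everything before it has no valleys.
incIndicator-++-0∷ : ∀ k A B →
  incIndicator (suc k) (map suc A ++ 0 ∷ map suc B) ≡ incIndicator 0 A * incIndicator k B
incIndicator-++-0∷ k [] B rewrite increasingᵇ-0∷ B | length-map suc B = sym (+-identityʳ _)
incIndicator-++-0∷ k (a ∷ A) B
  rewrite increasingᵇ-++-0∷ a A (map suc B) | ∧-zeroʳ (increasingᵇ (a ∷ A)) = refl

incIndicator-zero-++-∷ : ∀ A x B → incIndicator 0 (A ++ x ∷ B) ≡ 0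
incIndicator-zero-++-∷ [] x B = cong indicator (∧-zeroʳ (increasingᵇ (x ∷ B)))
incIndicator-zero-++-∷ (a ∷ A) x B = cong indicator (∧-zeroʳ (increasingᵇ (a ∷ A ++ x ∷ B)))

-- The entry 0 is first, last, or a valley.
incWeight-split : ∀ k α β → incWeight k (map suc α ++ 0 ∷ map suc β) ≡
  isEmpty α * incWeight k β + (incWeight k ⁺) α * isEmpty β + (incWeight 0 ⁺) α * (incWeightPred k ⁺) β
incWeight-split k [] β =
  trans (cong (incIndicator k) (valleyHeights-0∷ (map suc β)))
  (trans (incWeight-orderInvariant k suc-monotone β)
         (solve 1 (λ x → x := (con 1 :* x) :+ con 0 :+ con 0) refl (incWeight k β)))
incWeight-split k α@(_ ∷ _) [] =
  trans (cong (incIndicator k) (valleyHeights-++-0 (map suc α)))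
  (trans (incWeight-orderInvariant k suc-monotone α)
         (solve 2 (λ x y → x := con 0 :+ x :* con 1 :+ y :* con 0) refl (incWeight k α) (incWeight 0 α)))
incWeight-split k α@(a ∷ α′) β@(b ∷ β′) = trans (cong (incIndicator k) valleys) (middle k)
  where
  valleys : valleyHeights (map suc α ++ 0 ∷ map suc β) ≡ map suc (valleyHeights α) ++ 0 ∷ map suc (valleyHeights β)
  valleys = trans (valleyHeights-++-0∷ a α′ b (map suc β′))
                  (cong₂ (λ A B → A ++ 0 ∷ B) (valleyHeights-map suc-monotone α) (valleyHeights-map suc-monotone β))
  middle : ∀ k → incIndicator k (map suc (valleyHeights α) ++ 0 ∷ map suc (valleyHeights β)) ≡
    0 + incWeight k α * 0 + incWeight 0 α * incWeightPred k β
  middle zero = trans (incIndicator-zero-++-∷ (map suc (valleyHeights α)) 0 _)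
    (solve 1 (λ x → con 0 := con 0 :+ x :* con 0 :+ x :* con 0) refl (incWeight 0 α))
  middle (suc k) = trans (incIndicator-++-0∷ k (valleyHeights α) (valleyHeights β))
    (solve 3 (λ x y z → y :* z := con 0 :+ x :* con 0 :+ y :* z) refl
       (incWeight (suc k) α) (incWeight 0 α) (incWeight k β))

length-filterᵇ : ∀ (p : List ℕ → Bool) L → length (filterᵇ p L) ≡ sum (map (indicator ∘ p) L)
length-filterᵇ p [] = refl
length-filterᵇ p (σ ∷ L) with p σ
... | true = cong suc (length-filterᵇ p L)
... | false = length-filterᵇ p L

sum-map-insertions : ∀ (f : Weight) x l → sum (map f (insertions x l)) ≡ insertSum x f l
sum-map-insertions f x [] = +-identityʳ (f (x ∷ []))
sum-map-insertions f x (z ∷ zs) = cong (f (x ∷ z ∷ zs) +_)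
  (trans (cong sum (sym (map-∘ (insertions x zs)))) (sum-map-insertions (f ∘ (z ∷_)) x zs))

sum-map-concatMap : ∀ (f : Weight) (g : List ℕ → List (List ℕ)) L →
  sum (map f (concatMap g L)) ≡ sum (map (λ σ → sum (map f (g σ))) L)
sum-map-concatMap f g [] = refl
sum-map-concatMap f g (σ ∷ L) =
  trans (cong sum (map-++ f (g σ) (concatMap g L)))
  (trans (sum-++ (map f (g σ)) (map f (concatMap g L)))
         (cong (sum (map f (g σ)) +_) (sum-map-concatMap f g L)))

sum-map-perms : ∀ n (f : Weight) → sum (map f (perms n)) ≡ arrangeSum f (applyDownFrom suc n)
sum-map-perms zero f = +-identityʳ (f [])
sum-map-perms (suc n) f =
  trans (sum-map-concatMap f (insertions (suc n)) (perms n))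
  (trans (cong sum (map-cong (λ σ → sum-map-insertions f (suc n) σ) (perms n)))
         (sum-map-perms n (insertSum (suc n) f)))

incVal≡permSum : ∀ n k → incVal n k ≡ permSum (incWeight k) n
incVal≡permSum n k =
  begin
    length (filterᵇ (λ π → isIncreasingPerm π ∧ (numValleys π ≡ᵇ k)) (perms n))
  ≡⟨ length-filterᵇ _ (perms n) ⟩
    sum (map (incWeight k) (perms n))
  ≡⟨ sum-map-perms n (incWeight k) ⟩
    arrangeSum (incWeight k) (applyDownFrom suc n)
  ≡⟨ cong (arrangeSum (incWeight k)) (sym (map-downFrom suc n)) ⟩
    arrangeSum (incWeight k) (map suc (downFrom n))
  ≡⟨ arrangeSum-map suc (incWeight k) (downFrom n) ⟩
    arrangeSum (incWeight k ∘ map suc) (downFrom n)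
  ≡⟨ arrangeSum-cong (incWeight-orderInvariant k suc-monotone) (downFrom n) ⟩
    permSum (incWeight k) n
  ∎
  where open ≡-Reasoning

permSum-suc-cutAt0 : ∀ (f : Weight) n →
  permSum f (suc n) ≡ arrangeSum (splitSum (λ α β → f (map suc α ++ 0 ∷ map suc β))) (downFrom n)
permSum-suc-cutAt0 f n =
  begin
    arrangeSum f (downFrom (suc n))
  ≡⟨ cong (arrangeSum f) (sym (trans (cong (_++ [ 0 ]) (map-downFrom suc n)) (downFrom-∷ʳ n))) ⟩
    arrangeSum f (map suc (downFrom n) ++ [ 0 ])
  ≡⟨ arrangeSum-++-[] f 0 (map suc (downFrom n)) ⟩
    arrangeSum (insertSum 0 f) (map suc (downFrom n))
  ≡⟨ arrangeSum-map suc (insertSum 0 f) (downFrom n) ⟩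
    arrangeSum (insertSum 0 f ∘ map suc) (downFrom n)
  ≡⟨ arrangeSum-cong (splitSum-map suc (λ α β → f (α ++ 0 ∷ β))) (downFrom n) ⟩
    arrangeSum (splitSum (λ α β → f (map suc α ++ 0 ∷ map suc β))) (downFrom n)
  ∎
  where open ≡-Reasoning

permSum-incWeight-suc : ∀ k n → permSum (incWeight k) (suc n) ≡
  (permSum (incWeight k) n + permSum (incWeight k ⁺) n)
    + binomialConv (permSum (incWeight 0 ⁺)) (permSum (incWeightPred k ⁺)) n
permSum-incWeight-suc k n =
  begin
    permSum (incWeight k) (suc n)
  ≡⟨ permSum-suc-cutAt0 (incWeight k) n ⟩
    arrangeSum (splitSum (λ α β → incWeight k (map suc α ++ 0 ∷ map suc β))) xs
  ≡⟨ arrangeSum-cong (splitSum-cong (incWeight-split k)) xs ⟩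
    arrangeSum (splitSum (λ α β → (isEmpty ⊗ incWeight k) α β + (incWeight k ⁺ ⊗ isEmpty) α β
                                   + (incWeight 0 ⁺ ⊗ incWeightPred k ⁺) α β)) xs
  ≡⟨ trans (arrangeSum-splitSum-+ _ (incWeight 0 ⁺ ⊗ incWeightPred k ⁺) xs)
           (cong (_+ arrangeSum (splitSum (incWeight 0 ⁺ ⊗ incWeightPred k ⁺)) xs)
                 (arrangeSum-splitSum-+ (isEmpty ⊗ incWeight k) (incWeight k ⁺ ⊗ isEmpty) xs)) ⟩
    (arrangeSum (splitSum (isEmpty ⊗ incWeight k)) xs + arrangeSum (splitSum (incWeight k ⁺ ⊗ isEmpty)) xs)
      + arrangeSum (splitSum (incWeight 0 ⁺ ⊗ incWeightPred k ⁺)) xs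
  ≡⟨ cong₂ _+_ (cong₂ _+_ (arrangeSum-splitSum-isEmptyˡ (incWeight k) xs)
                          (arrangeSum-splitSum-isEmptyʳ (incWeight k ⁺) xs))
               (trans (arrangeSum-splitSum (incWeight 0 ⁺) (incWeightPred k ⁺) xs)
                      (distributeSum-permSum (⁺-orderInvariant (incWeight-orderInvariant 0))
                                             (⁺-orderInvariant (incWeightPred-orderInvariant k)) n)) ⟩
    (permSum (incWeight k) n + permSum (incWeight k ⁺) n)
      + binomialConv (permSum (incWeight 0 ⁺)) (permSum (incWeightPred k ⁺)) n
  ∎
  where
  open ≡-Reasoning
  xs = downFrom n

permSum-incWeightPred-zero : ∀ m → permSum (incWeightPred 0 ⁺) m ≡ 0
permSum-incWeightPred-zero zero = refl
permSum-incWeightPred-zero (suc m) = trans (permSum-⁺ (incWeightPred 0) (suc m) z<s) (arrangeSum-zero (downFrom (suc m)))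

m+m≡2*m : ∀ m → m + m ≡ 2 * m
m+m≡2*m m = cong (m +_) (sym (+-identityʳ m))

permSum-incWeight-zero : ∀ m → permSum (incWeight 0) (suc m) ≡ 2 ^ m
permSum-incWeight-zero zero = refl
permSum-incWeight-zero (suc m) =
  begin
    permSum (incWeight 0) (suc (suc m))
  ≡⟨ permSum-incWeight-suc 0 (suc m) ⟩
    (P + permSum (incWeight 0 ⁺) (suc m))
      + binomialConv (permSum (incWeight 0 ⁺)) (permSum (incWeightPred 0 ⁺)) (suc m)
  ≡⟨ cong₂ _+_ (cong (P +_) (permSum-⁺ (incWeight 0) (suc m) z<s))
               (binomialConv-vanishʳ (permSum (incWeight 0 ⁺)) permSum-incWeightPred-zero (suc m)) ⟩
    (P + P) + 0
  ≡⟨ trans (+-identityʳ (P + P)) (m+m≡2*m P) ⟩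
    2 * P
  ≡⟨ cong (2 *_) (permSum-incWeight-zero m) ⟩
    2 ^ suc m
  ∎
  where
  open ≡-Reasoning
  P = permSum (incWeight 0) (suc m)

incVal-noValleys : ∀ m → incVal (suc m) 0 ≡ 2 ^ m
incVal-noValleys m = trans (incVal≡permSum (suc m) 0) (permSum-incWeight-zero m)

incVal-recurrence : ∀ n k → incVal (suc (suc n)) (suc k) ≡
  2 * incVal (suc n) (suc k) + sumUpTo n (λ i → (suc n C suc i) * 2 ^ i * incVal (n ∸ i) k)
incVal-recurrence n k =
  begin
    incVal (suc (suc n)) (suc k)
  ≡⟨ incVal≡permSum (suc (suc n)) (suc k) ⟩
    permSum (incWeight (suc k)) (suc (suc n))
  ≡⟨ permSum-incWeight-suc (suc k) (suc n) ⟩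
    (P + permSum (incWeight (suc k) ⁺) (suc n)) + binomialConv c d (suc n)
  ≡⟨ cong₂ _+_ (trans (cong (P +_) (permSum-⁺ (incWeight (suc k)) (suc n) z<s)) (m+m≡2*m P))
               (binomialConv-interior refl refl n) ⟩
    2 * P + sumUpTo n (λ i → (suc n C suc i) * c (suc i) * d (n ∸ i))
  ≡⟨ cong₂ (λ t u → 2 * t + u) (sym (incVal≡permSum (suc n) (suc k))) (sumUpTo-cong n (λ {i} i<n →
       cong₂ (λ t u → (suc n C suc i) * t * u)
         (trans (permSum-⁺ (incWeight 0) (suc i) z<s) (permSum-incWeight-zero i))
         (trans (permSum-⁺ (incWeight k) (n ∸ i) (m<n⇒0<n∸m i<n)) (sym (incVal≡permSum (n ∸ i) k))))) ⟩
    2 * incVal (suc n) (suc k) + sumUpTo n (λ i → (suc n C suc i) * 2 ^ i * incVal (n ∸ i) k)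
  ∎
  where
  open ≡-Reasoning
  P = permSum (incWeight (suc k)) (suc n)
  c d : ℕ → ℕ
  c = permSum (incWeight 0 ⁺)
  d = permSum (incWeightPred (suc k) ⁺)

corollary2p2 : (incVal 0 0 ≡ 1)
    × ((n : ℕ) → n ≥ 1 → incVal n 0 ≡ 2 ^ (n ∸ 1))
    × ((n k : ℕ) → n ≥ 1 → k ≥ 1 →
        incVal (suc n) k ≡ 2 * incVal n k
          + sumFromTo 1 (n ∸ 1) (λ i → (n C i) * (2 ^ (i ∸ 1)) * incVal (n ∸ i) (k ∸ 1)))
corollary2p2 = refl , noValleys , recurrence
  where
  noValleys : (n : ℕ) → n ≥ 1 → incVal n 0 ≡ 2 ^ (n ∸ 1)
  noValleys (suc m) _ = incVal-noValleys m
  recurrence : (n k : ℕ) → n ≥ 1 → k ≥ 1 →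
    incVal (suc n) k ≡ 2 * incVal n k
      + sumFromTo 1 (n ∸ 1) (λ i → (n C i) * (2 ^ (i ∸ 1)) * incVal (n ∸ i) (k ∸ 1))
  -- sumFromTo 1 n f unfolds to sumUpTo n (f ∘ suc)
  recurrence (suc n) (suc k) _ _ = incVal-recurrence n k
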